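{- Let $\{T_\alpha \mid 1 \le \alpha < \omega_1\}$ be the family of rooted trees constructed below, with any admissible choice of the functions $\psi_\beta$ at the limit stages. Then for all ordinals $\alpha, \beta$ with $1 \le \alpha < \beta < \omega_1$ we have $T_\alpha \preceq T_\beta$ and $T_\beta \not\preceq T_\alpha$.
   Context: All trees are locally finite. A rooted tree $T$ carries its tree-order: $a \le b$ iff $a$ lies on the path from the root of $T$ to $b$. For rooted trees $T, U$, write $T \preceq U$ ($T$ is a topological minor of $U$) if some subdivision $T'$ of $T$ is isomorphic to a subtree of $U$ via an isomorphism $\phi$ preserving tree-order: $x \le y$ in $T'$ implies $\phi(x) \le \phi(y)$ in $U$. Equivalently, there is a tree-order preserving embedding of $T$ into $U$ in this sense. "Attaching" a rooted tree to a vertex $v$ means joining $v$ by a new edge to the root of a fresh disjoint copy of that tree. The construction is by transfinite recursion on $1 \le \beta < \omega_1$: - $T_1$ is a ray $v_1 v_2 v_3 \ldots$ rooted at $v_1$. - If $\beta = \alpha + 1$, take a ray $R = v_1 v_2 v_3\ldots$ rooted at $v_1$ (the spine) and attach to each $v_i$ its own copy of $T_\alpha$. The result $T_\beta$ has root $v_1$. - If $\beta$ is a limit ordinal, choose any strictly increasing function $\psi_\beta : \omega \to \beta \setminus \{0\}$ whose range is cofinal in $\beta$. Take a ray $R = v_1 v_2 \ldots$ rooted at $v_1$ (the spine) and attach to each $v_i$ its own copy of $T_{\psi_\beta(i)}$. The result $T_\beta$ has root $v_1$. -}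

module Defs where

open import Data.Nat using (ℕ; zero; suc; _<_)
open import Data.List using (List; []; _∷_; _++_; [_])
open import Data.Product using (Σ; ∃; _×_; _,_)
open import Data.Unit using (⊤)
open import Relation.Binary.PropositionalEquality using (_≡_; _≢_)

-- Countable ordinals ≥ 1 as Brouwer ordinal notations.
-- `one` denotes 1, `suc a` denotes a + 1, `lim f` denotes sup_i f i.

data Ord : Set where
  one : Ord
  suc : Ord → Ord
  lim : (ℕ → Ord) → Ord

infix 4 _≤ₒ_ _<ₒ_
data _≤ₒ_ : Ord → Ord → Set where
  ≤-one      : ∀ {a} → one ≤ₒ a
  ≤-suc      : ∀ {a b} → a ≤ₒ b → suc a ≤ₒ suc b
  ≤-step     : ∀ {a} → a ≤ₒ suc a
  ≤-cocone   : ∀ {a f} (i : ℕ) → a ≤ₒ f i → a ≤ₒ lim f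
  ≤-limiting : ∀ {f b} → (∀ i → f i ≤ₒ b) → lim f ≤ₒ b
  ≤-trans    : ∀ {a b c} → a ≤ₒ b → b ≤ₒ c → a ≤ₒ c

_<ₒ_ : Ord → Ord → Set
a <ₒ b = suc a ≤ₒ b

-- Well-formed notations: every limit is given by a strictly increasing
-- sequence (this sequence plays the role of ψ_β; its range is cofinal
-- in β = sup and lies in β ∖ {0}).
data WF : Ord → Set where
  wf-one : WF one
  wf-suc : ∀ {a} → WF a → WF (suc a)
  wf-lim : ∀ {f} → (∀ i → WF (f i)) → (∀ i → f i <ₒ f (suc i)) → WF (lim f)

-- A vertex is an address (list of child
-- indices from the root); a tree is given by its degree function:
-- `t xs` = number of children of the vertex with address xs.
-- Children of xs are xs ++ [ i ] for i < t xs.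

Tree : Set
Tree = List ℕ → ℕ

Valid : Tree → List ℕ → Set
Valid t []       = ⊤
Valid t (i ∷ xs) = (i < t []) × Valid (λ ys → t (i ∷ ys)) xs

-- Tree-order of addresses: xs < ys (strictly below) iff xs is a proper prefix.
-- Tree-order preserving topological embedding of T into U: vertices of T
-- go to vertices of U, each edge x — x·i (x the parent) goes to the
-- upward path from φ x to φ (x·i) in U (φ x strictly below φ (x·i)), and
-- the paths of distinct edges leaving x leave φ x through distinct
-- children of φ x (so the image of the subdivision is a subtree of U,
-- isomorphic to a subdivision of T via a tree-order preserving map).
record _≼_ (T U : Tree) : Set where
  field
    φ      : List ℕ → List ℕ
    valid  : ∀ xs → Valid T xs → Valid U (φ xs)
    above  : ∀ xs i → Valid T (xs ++ [ i ]) →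
             Σ ℕ λ k → Σ (List ℕ) λ ks → φ (xs ++ [ i ]) ≡ φ xs ++ (k ∷ ks)
    branch : ∀ xs i j → Valid T (xs ++ [ i ]) → Valid T (xs ++ [ j ]) → i ≢ j →
             ∀ k ks k′ ks′ →
             φ (xs ++ [ i ]) ≡ φ xs ++ (k ∷ ks) →
             φ (xs ++ [ j ]) ≡ φ xs ++ (k′ ∷ ks′) → k ≢ k′

-- spine f : a ray v₀ v₁ v₂ … (child 0 of vᵢ is vᵢ₊₁) with a copy of f i
-- attached to vᵢ (as child 1).
spine : (ℕ → Tree) → Tree
spine f []                 = 2
spine f (zero ∷ xs)        = spine (λ i → f (suc i)) xs
spine f (suc zero ∷ xs)    = f 0 xs
spine f (suc (suc _) ∷ xs) = 0

T : Ord → Tree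
T one     = λ _ → 1
T (suc a) = spine (λ _ → T a)
T (lim f) = spine (λ i → T (f i))

-- The ray T 1 embeds everywhere.  When α and β are
-- both successors or both limits, the spine of T α is mapped along the spine of T β, the copy
-- attached at its i-th vertex going into the copy attached at the n i-th vertex, for a strictly
-- increasing n chosen (using cofinality of ψ_β) so that the attached trees of T β are large enough.
-- Otherwise T α already embeds into a single tree attached to the spine of T β.
--
-- Since T α ≼ T (α + 1) ≼ T β, strictness reduces to T (α + 1) ⋠ T α.  An embedding of one spine
-- into another maps the root either into an attached tree, or to a spine vertex; such a vertex has
-- only two children, which must carry the images of the two edges at the root, so one of those
-- goes into an attached tree.  Either way T α embeds into a tree attached to the spine of T α:
-- T (α − 1) when α is a successor, giving T α ≼ T (α − 1), or some T (ψ m) when α is a limit,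
-- giving T (ψ m + 1) ≼ T α ≼ T (ψ m); both contradict the induction hypothesis.  At the bottom,
-- a ray has no vertex with two children.
module Submission where

open import Defs
open import Data.Empty using (⊥; ⊥-elim)
open import Data.List using (List; []; _∷_; _++_; [_]; length; drop; replicate)
open import Data.List.Properties using (∷-injectiveˡ; ++-assoc; ++-identityʳ; ++-cancelˡ)
open import Data.Nat using (ℕ; zero; suc; _+_; _≤_; _<_; _≤′_; ≤′-refl; ≤′-step; s≤s; z≤n)
open import Data.Nat.Properties using (≤⇒≤′; n<1⇒n≡0; n<1+n; m≤n+m; m≤m+n; m≤n⇒m≤1+n; ≤-refl)
open import Data.Product using (Σ; _×_; _,_; proj₁; proj₂; map₁; map₂)
open import Data.Sum using (_⊎_; inj₁; inj₂)
open import Data.Unit using (⊤; tt)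
open import Function using (_∘_)
open import Relation.Nullary using (¬_)
open import Relation.Binary.PropositionalEquality
  using (_≡_; _≢_; refl; sym; trans; cong; cong₂; subst; module ≡-Reasoning)

private
  variable
    S U V : Tree

-- _≤ₒ_ computed by recursion on the notations, so that it can be inspected by pattern matching;
-- ≤ₒ⇒≤ᵛ translates derivations.
infix 4 _≤ᵛ_ _<ᵛ_

mutual
  _≤ᵛ_ : Ord → Ord → Set
  one   ≤ᵛ b = ⊤
  suc a ≤ᵛ b = a <ᵛ b
  lim f ≤ᵛ b = ∀ i → f i ≤ᵛ b

  _<ᵛ_ : Ord → Ord → Set
  a <ᵛ one   = ⊥
  a <ᵛ suc b = a ≤ᵛ b
  a <ᵛ lim g = Σ ℕ λ i → a <ᵛ g i

≤ᵛ-cocone : ∀ a f i → a ≤ᵛ f i → a ≤ᵛ lim f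
≤ᵛ-cocone one     f i p = tt
≤ᵛ-cocone (suc a) f i p = i , p
≤ᵛ-cocone (lim h) f i p = λ k → ≤ᵛ-cocone (h k) f i (p k)

≤ᵛ-refl : ∀ a → a ≤ᵛ a
≤ᵛ-refl one     = tt
≤ᵛ-refl (suc a) = ≤ᵛ-refl a
≤ᵛ-refl (lim f) = λ i → ≤ᵛ-cocone (f i) f i (≤ᵛ-refl (f i))

mutual
  ≤ᵛ-sucʳ : ∀ a b → a ≤ᵛ b → a ≤ᵛ suc b
  ≤ᵛ-sucʳ one     b p = tt
  ≤ᵛ-sucʳ (suc a) b p = <ᵛ⇒≤ᵛ a b p
  ≤ᵛ-sucʳ (lim f) b p = λ i → ≤ᵛ-sucʳ (f i) b (p i)

  <ᵛ⇒≤ᵛ : ∀ a b → a <ᵛ b → a ≤ᵛ b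
  <ᵛ⇒≤ᵛ a (suc b) p       = ≤ᵛ-sucʳ a b p
  <ᵛ⇒≤ᵛ a (lim g) (i , p) = ≤ᵛ-cocone a g i (<ᵛ⇒≤ᵛ a (g i) p)

mutual
  ≤ᵛ-trans : ∀ a b c → a ≤ᵛ b → b ≤ᵛ c → a ≤ᵛ c
  ≤ᵛ-trans one     b c p q = tt
  ≤ᵛ-trans (suc a) b c p q = <ᵛ-≤ᵛ-trans a b c p q
  ≤ᵛ-trans (lim f) b c p q = λ i → ≤ᵛ-trans (f i) b c (p i) q

  <ᵛ-≤ᵛ-trans : ∀ a b c → a <ᵛ b → b ≤ᵛ c → a <ᵛ c
  <ᵛ-≤ᵛ-trans a (suc b) c p       q = ≤ᵛ-<ᵛ-trans a b c p q
  <ᵛ-≤ᵛ-trans a (lim g) c (i , p) q = <ᵛ-≤ᵛ-trans a (g i) c p (q i)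

  ≤ᵛ-<ᵛ-trans : ∀ a b c → a ≤ᵛ b → b <ᵛ c → a <ᵛ c
  ≤ᵛ-<ᵛ-trans a b (suc c) p q       = ≤ᵛ-trans a b c p q
  ≤ᵛ-<ᵛ-trans a b (lim h) p (i , q) = i , ≤ᵛ-<ᵛ-trans a b (h i) p q

≤ₒ⇒≤ᵛ : ∀ {a b} → a ≤ₒ b → a ≤ᵛ b
≤ₒ⇒≤ᵛ ≤-one                      = tt
≤ₒ⇒≤ᵛ (≤-suc p)                  = ≤ₒ⇒≤ᵛ p
≤ₒ⇒≤ᵛ (≤-step {a})               = ≤ᵛ-sucʳ a a (≤ᵛ-refl a)
≤ₒ⇒≤ᵛ (≤-cocone {a} {f} i p)     = ≤ᵛ-cocone a f i (≤ₒ⇒≤ᵛ p)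
≤ₒ⇒≤ᵛ (≤-limiting p)             = λ i → ≤ₒ⇒≤ᵛ (p i)
≤ₒ⇒≤ᵛ (≤-trans {a} {b} {c} p q)  = ≤ᵛ-trans a b c (≤ₒ⇒≤ᵛ p) (≤ₒ⇒≤ᵛ q)

Increasing : (ℕ → Ord) → Set
Increasing f = ∀ i → f i <ᵛ f (suc i)

Increasing-<ₒ : ∀ {f} → (∀ i → f i <ₒ f (suc i)) → Increasing f
Increasing-<ₒ f<f i = ≤ₒ⇒≤ᵛ (f<f i)

Increasing-mono : ∀ g {j k} → Increasing g → j ≤′ k → g j ≤ᵛ g k
Increasing-mono g {j} g< ≤′-refl            = ≤ᵛ-refl (g j)
Increasing-mono g {j} g< (≤′-step {k} j≤′k) =
  ≤ᵛ-trans (g j) (g k) (g (suc k)) (Increasing-mono g g< j≤′k) (<ᵛ⇒≤ᵛ (g k) (g (suc k)) (g< k))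

lim-≤ᵛ⇒<ᵛ : ∀ f b → Increasing f → lim f ≤ᵛ b → ∀ i → f i <ᵛ b
lim-≤ᵛ⇒<ᵛ f b f< p i = <ᵛ-≤ᵛ-trans (f i) (f (suc i)) b (f< i) (p (suc i))

dominating-subsequence : ∀ (f g : ℕ → Ord) → Increasing g → (∀ i → Σ ℕ λ j → f i <ᵛ g j) →
                         Σ (ℕ → ℕ) λ n → (∀ i → n i < n (suc i)) × (∀ i → f i ≤ᵛ g (n i))
dominating-subsequence f g g< bound = n , n< , f≤gn
  where
  j : ℕ → ℕ
  j i = proj₁ (bound i)

  n : ℕ → ℕ
  n zero    = j zero
  n (suc i) = suc (n i + j (suc i))

  n< : ∀ i → n i < n (suc i)
  n< i = s≤s (m≤m+n (n i) (j (suc i)))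

  j≤n : ∀ i → j i ≤ n i
  j≤n zero    = ≤-refl
  j≤n (suc i) = m≤n⇒m≤1+n (m≤n+m (j (suc i)) (n i))

  f≤gn : ∀ i → f i ≤ᵛ g (n i)
  f≤gn i = ≤ᵛ-trans (f i) (g (j i)) (g (n i)) (<ᵛ⇒≤ᵛ (f i) (g (j i)) (proj₂ (bound i)))
                    (Increasing-mono g g< (≤⇒≤′ (j≤n i)))

++-cancelˡ-head : ∀ (p : List ℕ) {a b as bs} → p ++ a ∷ as ≡ p ++ b ∷ bs → a ≡ b
++-cancelˡ-head p e = ∷-injectiveˡ (++-cancelˡ p _ _ e)

≡-++-drop-length : ∀ (p : List ℕ) {l} z → l ≡ p ++ z → l ≡ p ++ drop (length p) l
≡-++-drop-length []      z _    = refl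
≡-++-drop-length (x ∷ p) z refl = cong (x ∷_) (≡-++-drop-length p z refl)

-- zeros m is the address of the m-th vertex of the spine.
zeros : ℕ → List ℕ
zeros m = replicate m 0

zeros-< : ∀ {m k} → m < k → Σ (List ℕ) λ r → zeros k ≡ zeros m ++ 0 ∷ r
zeros-< {zero}  {suc k} _         = zeros k , refl
zeros-< {suc m} {suc k} (s≤s m<k) = map₂ (cong (0 ∷_)) (zeros-< m<k)

Sub : Tree → List ℕ → Tree
Sub U p ys = U (p ++ ys)

Valid-++⁻ : ∀ U p q → Valid U (p ++ q) → Valid U p × Valid (Sub U p) q
Valid-++⁻ U []      q v        = tt , v
Valid-++⁻ U (i ∷ p) q (i< , v) = map₁ (i< ,_) (Valid-++⁻ (Sub U [ i ]) p q v)

Valid-++⁺ : ∀ U p q → Valid U p → Valid (Sub U p) q → Valid U (p ++ q)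
Valid-++⁺ U []      q _        vq = vq
Valid-++⁺ U (i ∷ p) q (i< , vp) vq = i< , Valid-++⁺ (Sub U [ i ]) p q vp vq

Valid-∷⁻ : ∀ U p k ks → Valid U (p ++ k ∷ ks) → Valid U (p ++ [ k ]) × Valid (Sub U (p ++ [ k ])) ks
Valid-∷⁻ U p k ks v = Valid-++⁻ U (p ++ [ k ]) ks (subst (Valid U) (sym (++-assoc p [ k ] ks)) v)

Valid-child : ∀ U p k ks → Valid U (p ++ k ∷ ks) → k < U p
Valid-child U []      k ks (k< , _) = k<
Valid-child U (i ∷ p) k ks (_ , v)  = Valid-child (Sub U [ i ]) p k ks v

Valid-resp : ∀ {U U′ : Tree} → (∀ ys → U ys ≡ U′ ys) → ∀ xs → Valid U xs → Valid U′ xs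
Valid-resp U≡U′ []       _        = tt
Valid-resp U≡U′ (i ∷ xs) (i< , v) = subst (i <_) (U≡U′ []) i< , Valid-resp (U≡U′ ∘ (i ∷_)) xs v

open _≼_

-- The image of the edge xs — xs·i leaves φ xs through its child `exit` and then follows `trail`.
exit : (E : S ≼ U) → ∀ xs i → Valid S (xs ++ [ i ]) → ℕ
exit E xs i v = proj₁ (above E xs i v)

trail : (E : S ≼ U) → ∀ xs i → Valid S (xs ++ [ i ]) → List ℕ
trail E xs i v = proj₁ (proj₂ (above E xs i v))

exit-path : (E : S ≼ U) → ∀ xs i v → φ E (xs ++ [ i ]) ≡ φ E xs ++ exit E xs i v ∷ trail E xs i v
exit-path E xs i v = proj₂ (proj₂ (above E xs i v))

exit-injective : (E : S ≼ U) → ∀ xs {i j} vi vj → i ≢ j → exit E xs i vi ≢ exit E xs j vj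
exit-injective E xs vi vj i≢j =
  branch E xs _ _ vi vj i≢j _ _ _ _ (exit-path E xs _ vi) (exit-path E xs _ vj)

exit-< : (E : S ≼ U) → ∀ xs i v → exit E xs i v < U (φ E xs)
exit-< {U = U} E xs i v =
  Valid-child U (φ E xs) _ _ (subst (Valid U) (exit-path E xs i v) (valid E _ v))

≼-from-exits : (f : List ℕ → List ℕ) → (∀ xs → Valid S xs → Valid U (f xs)) →
               (step : ∀ xs i → Valid S (xs ++ [ i ]) →
                       Σ ℕ λ k → Σ (List ℕ) λ ks → f (xs ++ [ i ]) ≡ f xs ++ k ∷ ks) →
               (∀ xs i j vi vj → i ≢ j → proj₁ (step xs i vi) ≢ proj₁ (step xs j vj)) →
               S ≼ U
≼-from-exits {S = S} f f-valid step distinct = record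
  { φ = f ; valid = f-valid ; above = step ; branch = branches }
  where
  branches : ∀ xs i j vi vj → i ≢ j → ∀ k ks k′ ks′ →
             f (xs ++ [ i ]) ≡ f xs ++ k ∷ ks → f (xs ++ [ j ]) ≡ f xs ++ k′ ∷ ks′ → k ≢ k′
  branches xs i j vi vj i≢j k ks k′ ks′ ei ej k≡k′ =
    distinct xs i j vi vj i≢j (trans (sym (head ei vi)) (trans k≡k′ (head ej vj)))
    where
    head : ∀ {l k ks} → f (xs ++ [ l ]) ≡ f xs ++ k ∷ ks → (v : Valid S (xs ++ [ l ])) →
           k ≡ proj₁ (step xs l v)
    head e v = ++-cancelˡ-head (f xs) (trans (sym e) (proj₂ (proj₂ (step xs _ v))))

≼-respʳ : ∀ {U′} → (∀ ys → U ys ≡ U′ ys) → S ≼ U → S ≼ U′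
≼-respʳ U≡U′ E = record
  { φ      = φ E
  ; valid  = λ xs → Valid-resp U≡U′ (φ E xs) ∘ valid E xs
  ; above  = above E
  ; branch = branch E
  }

mutual
  φ-++ : (E : S ≼ U) → ∀ x ys → Valid S (x ++ ys) → Σ (List ℕ) λ w → φ E (x ++ ys) ≡ φ E x ++ w
  φ-++ E x []       _ = [] , trans (cong (φ E) (++-identityʳ x)) (sym (++-identityʳ (φ E x)))
  φ-++ E x (i ∷ ys) v = _ , proj₂ (φ-above-child E x i ys v)

  φ-above-child : (E : S ≼ U) → ∀ p c cs (v : Valid S (p ++ c ∷ cs)) →
                  Σ (List ℕ) λ w →
                    φ E (p ++ c ∷ cs) ≡ φ E p ++ exit E p c (proj₁ (Valid-∷⁻ S p c cs v)) ∷ w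
  φ-above-child {S = S} E p c cs v = trail E p c vc ++ w , (begin
    φ E (p ++ c ∷ cs)                                 ≡⟨ cong (φ E) (sym (++-assoc p [ c ] cs)) ⟩
    φ E ((p ++ [ c ]) ++ cs)                          ≡⟨ proj₂ rest ⟩
    φ E (p ++ [ c ]) ++ w                             ≡⟨ cong (_++ w) (exit-path E p c vc) ⟩
    (φ E p ++ exit E p c vc ∷ trail E p c vc) ++ w    ≡⟨ ++-assoc (φ E p) _ w ⟩
    φ E p ++ exit E p c vc ∷ trail E p c vc ++ w      ∎)
    where
    open ≡-Reasoning
    vc = proj₁ (Valid-∷⁻ S p c cs v)
    rest = φ-++ E (p ++ [ c ]) cs (subst (Valid S) (sym (++-assoc p [ c ] cs)) v)
    w = proj₁ rest

≼-trans : S ≼ U → U ≼ V → S ≼ V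
≼-trans {S} {U} {V} E F = ≼-from-exits (φ F ∘ φ E) (λ xs → valid F _ ∘ valid E xs) step distinct
  where
  image : ∀ {xs i} (v : Valid S (xs ++ [ i ])) → Valid U (φ E xs ++ exit E xs i v ∷ trail E xs i v)
  image v = subst (Valid U) (exit-path E _ _ v) (valid E _ v)

  step : ∀ xs i → Valid S (xs ++ [ i ]) →
         Σ ℕ λ k → Σ (List ℕ) λ ks → φ F (φ E (xs ++ [ i ])) ≡ φ F (φ E xs) ++ k ∷ ks
  step xs i v = _ , proj₁ through , trans (cong (φ F) (exit-path E xs i v)) (proj₂ through)
    where
    through = φ-above-child F (φ E xs) (exit E xs i v) (trail E xs i v) (image v)

  distinct : ∀ xs i j vi vj → i ≢ j → proj₁ (step xs i vi) ≢ proj₁ (step xs j vj)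
  distinct xs i j vi vj i≢j =
    exit-injective F (φ E xs) _ _ (exit-injective E xs vi vj i≢j)

prefix-≼ : ∀ p → (∀ ys → Valid S ys → Valid U (p ++ ys)) → S ≼ U
prefix-≼ p p-valid = ≼-from-exits (p ++_) p-valid
  (λ ys i _ → i , [] , sym (++-assoc p ys [ i ]))
  (λ _ _ _ _ _ i≢j → i≢j)

restrict : (E : S ≼ U) → ∀ x p → Valid S x → Σ (List ℕ) (λ w → φ E x ≡ p ++ w) → Sub S x ≼ Sub U p
restrict {S} {U} E x p vx (w₀ , φx≡p++w₀) = ≼-from-exits ψ ψ-valid step distinct
  where
  open ≡-Reasoning
  ψ : List ℕ → List ℕ
  ψ ys = drop (length p) (φ E (x ++ ys))

  φ≡p++ψ : ∀ ys → Valid (Sub S x) ys → φ E (x ++ ys) ≡ p ++ ψ ys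
  φ≡p++ψ ys v = ≡-++-drop-length p (w₀ ++ w) (begin
    φ E (x ++ ys)   ≡⟨ proj₂ (φ-++ E x ys (Valid-++⁺ S x ys vx v)) ⟩
    φ E x ++ w      ≡⟨ cong (_++ w) φx≡p++w₀ ⟩
    (p ++ w₀) ++ w  ≡⟨ ++-assoc p w₀ w ⟩
    p ++ w₀ ++ w    ∎)
    where w = proj₁ (φ-++ E x ys (Valid-++⁺ S x ys vx v))

  ψ-valid : ∀ ys → Valid (Sub S x) ys → Valid (Sub U p) (ψ ys)
  ψ-valid ys v = proj₂ (Valid-++⁻ U p (ψ ys)
    (subst (Valid U) (φ≡p++ψ ys v) (valid E (x ++ ys) (Valid-++⁺ S x ys vx v))))

  lift : ∀ {ys i} → Valid (Sub S x) (ys ++ [ i ]) → Valid S ((x ++ ys) ++ [ i ])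
  lift {ys} {i} v = subst (Valid S) (sym (++-assoc x ys [ i ])) (Valid-++⁺ S x _ vx v)

  step : ∀ ys i (v : Valid (Sub S x) (ys ++ [ i ])) →
         Σ ℕ λ k → Σ (List ℕ) λ ks → ψ (ys ++ [ i ]) ≡ ψ ys ++ k ∷ ks
  step ys i v = k , ks , ++-cancelˡ p _ _ (begin
    p ++ ψ (ys ++ [ i ])        ≡⟨ sym (φ≡p++ψ (ys ++ [ i ]) v) ⟩
    φ E (x ++ ys ++ [ i ])      ≡⟨ cong (φ E) (sym (++-assoc x ys [ i ])) ⟩
    φ E ((x ++ ys) ++ [ i ])    ≡⟨ exit-path E (x ++ ys) i (lift v) ⟩
    φ E (x ++ ys) ++ k ∷ ks     ≡⟨ cong (_++ k ∷ ks) (φ≡p++ψ ys vys) ⟩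
    (p ++ ψ ys) ++ k ∷ ks       ≡⟨ ++-assoc p (ψ ys) (k ∷ ks) ⟩
    p ++ ψ ys ++ k ∷ ks         ∎)
    where
    k = exit E (x ++ ys) i (lift v)
    ks = trail E (x ++ ys) i (lift v)
    vys = proj₁ (Valid-++⁻ (Sub S x) ys [ i ] v)

  distinct : ∀ ys i j vi vj → i ≢ j → proj₁ (step ys i vi) ≢ proj₁ (step ys j vj)
  distinct ys i j vi vj = exit-injective E (x ++ ys) (lift vi) (lift vj)

attach-Valid : ∀ f i ys → Valid (f i) ys → Valid (spine f) (zeros i ++ 1 ∷ ys)
attach-Valid f zero    ys v = s≤s (s≤s z≤n) , v
attach-Valid f (suc i) ys v = s≤s z≤n , attach-Valid (f ∘ suc) i ys v

spine-attached : ∀ f i ys → spine f (zeros i ++ 1 ∷ ys) ≡ f i ys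
spine-attached f zero    ys = refl
spine-attached f (suc i) ys = spine-attached (f ∘ suc) i ys

zeros-Valid : ∀ f m → Valid (spine f) (zeros m)
zeros-Valid f zero    = tt
zeros-Valid f (suc m) = s≤s z≤n , zeros-Valid (f ∘ suc) m

spine-zeros : ∀ f m → spine f (zeros m) ≡ 2
spine-zeros f zero    = refl
spine-zeros f (suc m) = spine-zeros (f ∘ suc) m

spine-vertex : ∀ f p → Valid (spine f) p →
               (Σ ℕ λ m → p ≡ zeros m) ⊎ (Σ ℕ λ m → Σ (List ℕ) λ r → p ≡ zeros m ++ 1 ∷ r)
spine-vertex f []                  _       = inj₁ (0 , refl)
spine-vertex f (zero ∷ p)          (_ , v) with spine-vertex (f ∘ suc) p v
... | inj₁ (m , e)     = inj₁ (suc m , cong (0 ∷_) e)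
... | inj₂ (m , r , e) = inj₂ (suc m , r , cong (0 ∷_) e)
spine-vertex f (suc zero ∷ p)      _       = inj₂ (0 , p , refl)
spine-vertex f (suc (suc _) ∷ p)   (s≤s (s≤s ()) , _)

spine-[0]-Valid : ∀ f → Valid (spine f) [ 0 ]
spine-[0]-Valid f = s≤s z≤n , tt

spine-[1]-Valid : ∀ f → Valid (spine f) [ 1 ]
spine-[1]-Valid f = s≤s (s≤s z≤n) , tt

attach : ∀ f i → f i ≼ spine f
attach f i = prefix-≼ (zeros i ++ [ 1 ])
  (λ ys v → subst (Valid (spine f)) (sym (++-assoc (zeros i) [ 1 ] ys)) (attach-Valid f i ys v))

ray-≼ : ∀ b → T one ≼ T b
ray-≼ b = prefix-≼ [] (ray-Valid b)
  where
  ray-Valid-spine : ∀ f ys → Valid (T one) ys → Valid (spine f) ys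
  ray-Valid-spine f []           _          = tt
  ray-Valid-spine f (zero ∷ ys)  (_ , v)    = s≤s z≤n , ray-Valid-spine (f ∘ suc) ys v
  ray-Valid-spine f (suc _ ∷ ys) (s≤s () , _)

  ray-Valid : ∀ b ys → Valid (T one) ys → Valid (T b) ys
  ray-Valid one     ys v = v
  ray-Valid (suc b) ys v = ray-Valid-spine _ ys v
  ray-Valid (lim g) ys v = ray-Valid-spine _ ys v

module SpineMap (G : ℕ → Tree) where
  image : (F : ℕ → Tree) (n : ℕ → ℕ) → (∀ i → F i ≼ G (n i)) → List ℕ → List ℕ
  image F n e []                 = zeros (n 0)
  image F n e (zero ∷ xs)        = image (F ∘ suc) (n ∘ suc) (e ∘ suc) xs
  image F n e (suc zero ∷ xs)    = zeros (n 0) ++ 1 ∷ φ (e 0) xs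
  image F n e (suc (suc _) ∷ xs) = []

  image-Valid : ∀ F n e xs → Valid (spine F) xs → Valid (spine G) (image F n e xs)
  image-Valid F n e []                 _       = zeros-Valid G (n 0)
  image-Valid F n e (zero ∷ xs)        (_ , v) = image-Valid (F ∘ suc) (n ∘ suc) (e ∘ suc) xs v
  image-Valid F n e (suc zero ∷ xs)    (_ , v) = attach-Valid G (n 0) _ (valid (e 0) xs v)
  image-Valid F n e (suc (suc _) ∷ xs) (s≤s (s≤s ()) , _)

  step : ∀ F n e → (∀ i → n i < n (suc i)) → ∀ xs i → Valid (spine F) (xs ++ [ i ]) →
         Σ ℕ λ k → Σ (List ℕ) λ ks → image F n e (xs ++ [ i ]) ≡ image F n e xs ++ k ∷ ks
  step F n e n< []                 zero          _       = 0 , zeros-< (n< 0)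
  step F n e n< []                 (suc zero)    _       = 1 , φ (e 0) [] , refl
  step F n e n< []                 (suc (suc _)) (s≤s (s≤s ()) , _)
  step F n e n< (zero ∷ xs)        i             (_ , v) =
    step (F ∘ suc) (n ∘ suc) (e ∘ suc) (n< ∘ suc) xs i v
  step F n e n< (suc zero ∷ xs)    i             (_ , v) =
    exit (e 0) xs i v , trail (e 0) xs i v ,
    trans (cong (λ z → zeros (n 0) ++ 1 ∷ z) (exit-path (e 0) xs i v))
          (sym (++-assoc (zeros (n 0)) (1 ∷ φ (e 0) xs) _))
  step F n e n< (suc (suc _) ∷ xs) i             (s≤s (s≤s ()) , _)

  distinct : ∀ F n e n< xs i j vi vj → i ≢ j →
             proj₁ (step F n e n< xs i vi) ≢ proj₁ (step F n e n< xs j vj)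
  distinct F n e n< []                 zero          zero          _ _ i≢j = ⊥-elim (i≢j refl)
  distinct F n e n< []                 zero          (suc zero)    _ _ _   = λ ()
  distinct F n e n< []                 (suc zero)    zero          _ _ _   = λ ()
  distinct F n e n< []                 (suc zero)    (suc zero)    _ _ i≢j = ⊥-elim (i≢j refl)
  distinct F n e n< []                 (suc (suc _)) _ (s≤s (s≤s ()) , _) _
  distinct F n e n< []                 _ (suc (suc _)) _ (s≤s (s≤s ()) , _)
  distinct F n e n< (zero ∷ xs)        i j (_ , vi) (_ , vj) =
    distinct (F ∘ suc) (n ∘ suc) (e ∘ suc) (n< ∘ suc) xs i j vi vj
  distinct F n e n< (suc zero ∷ xs)    i j (_ , vi) (_ , vj) = exit-injective (e 0) xs vi vj
  distinct F n e n< (suc (suc _) ∷ xs) i j (s≤s (s≤s ()) , _)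

spine-≼ : ∀ {F G : ℕ → Tree} (n : ℕ → ℕ) → (∀ i → n i < n (suc i)) → (∀ i → F i ≼ G (n i)) →
          spine F ≼ spine G
spine-≼ {F} {G} n n< e =
  ≼-from-exits (image F n e) (image-Valid F n e) (step F n e n<) (distinct F n e n<)
  where open SpineMap G

restrict-attached : ∀ h (E : S ≼ spine h) x m w → Valid S x → φ E x ≡ zeros m ++ 1 ∷ w →
                    Sub S x ≼ h m
restrict-attached h E x m w vx φx≡ = ≼-respʳ attached
  (restrict E x (zeros m ++ [ 1 ]) vx (w , trans φx≡ (sym (++-assoc (zeros m) [ 1 ] w))))
  where
  attached : ∀ ys → spine h ((zeros m ++ [ 1 ]) ++ ys) ≡ h m ys
  attached ys = trans (cong (spine h) (++-assoc (zeros m) [ 1 ] ys)) (spine-attached h m ys)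

spine-⋠-ray : ∀ f → ¬ (spine f ≼ T one)
spine-⋠-ray f E = exit-injective E [] v₀ v₁ (λ ())
  (trans (n<1⇒n≡0 (exit-< E [] 0 v₀)) (sym (n<1⇒n≡0 (exit-< E [] 1 v₁))))
  where
  v₀ = spine-[0]-Valid f
  v₁ = spine-[1]-Valid f

one-of-two : ∀ {a b} → a < 2 → b < 2 → a ≢ b → a ≡ 1 ⊎ b ≡ 1
one-of-two {1}           _               _               _   = inj₁ refl
one-of-two {_}     {1}   _               _               _   = inj₂ refl
one-of-two {0}     {0}   _               _               a≢b = ⊥-elim (a≢b refl)
one-of-two {suc (suc _)} (s≤s (s≤s ()))
one-of-two {0} {suc (suc _)} _           (s≤s (s≤s ()))

spine-const-≼-spine : ∀ h C → spine (λ _ → C) ≼ spine h → Σ ℕ λ m → C ≼ h m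
spine-const-≼-spine h C E = from-root (spine-vertex h (φ E []) (valid E [] tt))
  where
  v₀ = spine-[0]-Valid (λ _ → C)
  v₁ = spine-[1]-Valid (λ _ → C)

  from-root : (Σ ℕ λ m → φ E [] ≡ zeros m) ⊎ (Σ ℕ λ m → Σ (List ℕ) λ r → φ E [] ≡ zeros m ++ 1 ∷ r) →
              Σ ℕ λ m → C ≼ h m
  from-root (inj₂ (m , r , φ[]≡)) =
    m , ≼-trans (attach (λ _ → C) 0) (restrict-attached h E [] m r tt φ[]≡)
  from-root (inj₁ (m , φ[]≡))     =
    m , from-exits (one-of-two (bound v₀) (bound v₁) (exit-injective E [] v₀ v₁ λ ()))
    where
    bound : ∀ {i} v → exit E [] i v < 2
    bound v = subst (_ <_) (trans (cong (spine h) φ[]≡) (spine-zeros h m)) (exit-< E [] _ v)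

    exit-attached : ∀ {i} v → exit E [] i v ≡ 1 → Sub (spine (λ _ → C)) [ i ] ≼ h m
    exit-attached v k≡1 = restrict-attached h E _ m _ v
      (trans (exit-path E [] _ v) (cong₂ (λ p k → p ++ k ∷ trail E [] _ v) φ[]≡ k≡1))

    from-exits : exit E [] 0 v₀ ≡ 1 ⊎ exit E [] 1 v₁ ≡ 1 → C ≼ h m
    from-exits (inj₁ k≡1) = ≼-trans (attach (λ _ → C) 0) (exit-attached v₀ k≡1)
    from-exits (inj₂ k≡1) = exit-attached v₁ k≡1

T-mono : ∀ a b → WF a → WF b → a ≤ᵛ b → T a ≼ T b
T-mono one     b       _          _               _          = ray-≼ b
T-mono (suc a) (suc b) (wf-suc wa) (wf-suc wb)    a≤b        =
  spine-≼ (λ i → i) n<1+n (λ _ → T-mono a b wa wb a≤b)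
T-mono (suc a) (lim g) wa          (wf-lim wg _)  (j , a<gj) =
  ≼-trans (T-mono (suc a) (g j) wa (wg j) a<gj) (attach (λ i → T (g i)) j)
T-mono (lim f) one     (wf-lim _ f<) _            f≤1        =
  ⊥-elim (lim-≤ᵛ⇒<ᵛ f one (Increasing-<ₒ f<) f≤1 0)
T-mono (lim f) (suc b) (wf-lim wf f<) (wf-suc wb) f≤b+1      =
  ≼-trans (T-mono (lim f) b (wf-lim wf f<) wb (lim-≤ᵛ⇒<ᵛ f (suc b) (Increasing-<ₒ f<) f≤b+1))
          (attach (λ _ → T b) 0)
T-mono (lim f) (lim g) (wf-lim wf f<) (wf-lim wg g<) f≤g     =
  spine-≼ n n< (λ i → T-mono (f i) (g (n i)) (wf i) (wg (n i)) (f≤gn i))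
  where
  subsequence =
    dominating-subsequence f g (Increasing-<ₒ g<) (lim-≤ᵛ⇒<ᵛ f (lim g) (Increasing-<ₒ f<) f≤g)
  n = proj₁ subsequence
  n< = proj₁ (proj₂ subsequence)
  f≤gn = proj₂ (proj₂ subsequence)

T-suc-⋠ : ∀ a → WF a → ¬ (T (suc a) ≼ T a)
T-suc-⋠ one     _              = spine-⋠-ray _
T-suc-⋠ (suc a) (wf-suc wa) E  = T-suc-⋠ a wa (proj₂ (spine-const-≼-spine (λ _ → T a) (T (suc a)) E))
T-suc-⋠ (lim g) (wf-lim wg g<) E = T-suc-⋠ (g m) (wg m) (≼-trans Tgm+1≼Tlim Tlim≼Tgm)
  where
  into-attached = spine-const-≼-spine (λ i → T (g i)) (T (lim g)) E
  m = proj₁ into-attached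
  Tlim≼Tgm = proj₂ into-attached
  Tgm+1≼Tlim = T-mono (suc (g m)) (lim g) (wf-suc (wg m)) (wf-lim wg g<) (suc m , Increasing-<ₒ g< m)

theorem1 : ∀ (a b : Ord) → WF a → WF b → a <ₒ b → (T a ≼ T b) × ¬ (T b ≼ T a)
theorem1 a b wa wb a<b =
  ≼-trans (attach (λ _ → T a) 0) Ta+1≼Tb , λ Tb≼Ta → T-suc-⋠ a wa (≼-trans Ta+1≼Tb Tb≼Ta)
  where
  Ta+1≼Tb : T (suc a) ≼ T b
  Ta+1≼Tb = T-mono (suc a) b (wf-suc wa) wb (≤ₒ⇒≤ᵛ a<b)
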